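{- Let $q\ge2$ be a prime power and let $n,k,t,s$ be positive integers with $k\ge t+2$ and $n\ge 3k+3t+1+\log_q(13s)$. Let $$g_1(n,k,t,s)=\left({n-t\brack k-t}-q^{(k-t)(k+1-t)}{n-k-1\brack k-t}+s\right)\left({n-t\brack k-t}+\min\{s,q^{k-t+1}{t\brack 1}\}\right),$$ $$g_2(n,k,t)=q^{k-t}{t+1\brack 1}{n-t-1\brack k-t-1}{n-t-1\brack k-t}+{n-t-1\brack k-t-1}^2.$$ Then (i) $g_1(n,k,t,s)>\left({n-t\brack k-t}-q^{(k-t)(k+1-t)}{n-k-1\brack k-t}\right)\left({n-t\brack k-t}+q^{k-t+1}{t\brack 1}\right)$; and (ii) if $k\le 2t$ and $t\ne 2$, then $g_1(n,k,t,s)<g_2(n,k,t)$.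
   Context: Gaussian binomial: ${a\brack b}=\prod_{0\le i<b}\frac{q^{a-i}-1}{q^{b-i}-1}$ for positive integers $a,b$, ${a\brack 0}=1$, ${a\brack b}=0$ for $b<0$. -}

module Defs where

open import Data.Nat using (ℕ; zero; suc; _+_; _*_; _∸_; _^_; _≤_; _/_)
open import Data.Nat.Primality using (Prime)
open import Data.Product using (Σ; _×_)
open import Relation.Binary.PropositionalEquality using (_≡_)

IsPrimePower : ℕ → Set
IsPrimePower q = Σ ℕ λ p → Σ ℕ λ m → Prime p × (1 ≤ m) × (q ≡ p ^ m)

prodUpTo : ℕ → (ℕ → ℕ) → ℕ
prodUpTo zero    f = 1
prodUpTo (suc b) f = prodUpTo b f * f b

-- natural division, with the (never used, since q ≥ 2) convention m div 0 = 0
_div_ : ℕ → ℕ → ℕ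
m div zero    = 0
m div (suc d) = m / suc d

-- Gaussian binomial [a b]_q = ∏_{0≤i<b} (q^(a-i) - 1) / (q^(b-i) - 1)
-- (b = 0 gives the empty product 1; for a < b the factor with i = a is 0).
gauss : ℕ → ℕ → ℕ → ℕ
gauss q a b = prodUpTo b (λ i → q ^ (a ∸ i) ∸ 1) div prodUpTo b (λ i → q ^ (b ∸ i) ∸ 1)

{-# OPTIONS --safe #-}

-- Put m = k − t, a = n − k − 1, D = [n−t−1, m−1], E = [n−t−1, m] and [x] = [x, 1]. Pascal's rule
-- gives A = D + q^m E, and unfolding it m + 1 times gives A = V + B with V + Δ = [m+1] D for an
-- explicit Δ ≥ 0 (a hockey-stick sum and its defect). By the absorption identity
-- E (q^m − 1) = D (q^(a+1) − 1) we get A ≥ q^m E ≥ (q^(a+1) − 1) D > V C, as a ≥ 2m + t + 2;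
-- then V (A + C) ≤ V A + A < (V + s)(A + min(s, C)), which is (i).
-- For (ii), where m ≤ t, (V + s)(A + s) + Δ q^m E ≤ D² + q^m [m+1] D E + R with the excess
-- R = q [m] D² + s (V + A + s), so it suffices to beat R. If m < t, the surplus q^m q^(m+1) D E
-- of g₂ does. If m = t, then m ≥ 3 as t ≠ 2, and the last two terms of Δ give
-- Δ ≥ q^m q^(m−1) H + q [m] F with H = [n−t−3, m−2] and F = [n−t−2, m−2] ≤ 2 q^(m−2) H; then
-- Δ q^m E beats R because 3 D² ≤ 4 q^m F E (from the second absorption identity
-- D (q^(m−1) − 1) = (q^(n−t−1) − 1) F) and 13 s ≤ q^(a+1) ≤ F.
module Submission where

open import Defs
open import Data.Nat as ℕ using (ℕ; suc)

module QBinomial (q : ℕ) where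
  open import Data.Nat
  open import Data.Nat.Properties
  open import Data.Nat.DivMod using (m*n/n≡m)
  open import Data.Nat.Tactic.RingSolver using (solve-∀)
  open import Data.Sum using (inj₁; inj₂)
  open import Relation.Binary.PropositionalEquality hiding ([_])
  open import Relation.Nullary using (yes; no)

  qbinom : ℕ → ℕ → ℕ
  qbinom N       zero    = 1
  qbinom zero    (suc j) = 0
  qbinom (suc N) (suc j) = qbinom N j + q ^ suc j * qbinom N (suc j)

  [_] : ℕ → ℕ
  [ zero  ] = 0
  [ suc w ] = 1 + q * [ w ]

  qbinom[N,1]≡[N] : ∀ N → qbinom N 1 ≡ [ N ]
  qbinom[N,1]≡[N] zero    = refl
  qbinom[N,1]≡[N] (suc N) = cong suc (cong₂ _*_ (*-identityʳ q) (qbinom[N,1]≡[N] N))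

  [1+w]≡[w]+q^w : ∀ w → [ suc w ] ≡ [ w ] + q ^ w
  [1+w]≡[w]+q^w zero    = cong suc (*-zeroʳ q)
  [1+w]≡[w]+q^w (suc w) = begin
      1 + q * [ suc w ]          ≡⟨ cong (λ x → 1 + q * x) ([1+w]≡[w]+q^w w) ⟩
      1 + q * ([ w ] + q ^ w)    ≡⟨ cong suc (*-distribˡ-+ q [ w ] (q ^ w)) ⟩
      1 + q * [ w ] + q * q ^ w  ∎
    where open ≡-Reasoning

  q^w≤[1+w] : ∀ w → q ^ w ≤ [ suc w ]
  q^w≤[1+w] w = subst (q ^ w ≤_) (sym ([1+w]≡[w]+q^w w)) (m≤n+m (q ^ w) [ w ])

  []-mono-≤ : ∀ {w w′} → w ≤ w′ → [ w ] ≤ [ w′ ]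
  []-mono-≤ z≤n       = z≤n
  []-mono-≤ (s≤s w≤w′) = s≤s (*-monoʳ-≤ q ([]-mono-≤ w≤w′))

  hockeyStick : ℕ → ℕ → ℕ → ℕ
  hockeyStick j a zero    = 0
  hockeyStick j a (suc w) = qbinom (w + a) j + q ^ suc j * hockeyStick j a w

  qbinom-hockeyStick : ∀ j a w →
    qbinom (w + a) (suc j) ≡ hockeyStick j a w + q ^ (suc j * w) * qbinom a (suc j)
  qbinom-hockeyStick j a zero rewrite *-zeroʳ j = sym (+-identityʳ _)
  qbinom-hockeyStick j a (suc w) = begin
      qbinom (w + a) j + Q * qbinom (w + a) (suc j)
    ≡⟨ cong (λ x → qbinom (w + a) j + Q * x) (qbinom-hockeyStick j a w) ⟩
      qbinom (w + a) j + Q * (hockeyStick j a w + q ^ (suc j * w) * qbinom a (suc j))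
    ≡⟨ regroup (qbinom (w + a) j) Q (hockeyStick j a w) (q ^ (suc j * w)) (qbinom a (suc j)) ⟩
      hockeyStick j a (suc w) + Q * q ^ (suc j * w) * qbinom a (suc j)
    ≡⟨ cong (λ x → hockeyStick j a (suc w) + x * qbinom a (suc j))
            (sym (^-distribˡ-+-* q (suc j) (suc j * w))) ⟩
      hockeyStick j a (suc w) + q ^ (suc j + suc j * w) * qbinom a (suc j)
    ≡⟨ cong (λ e → hockeyStick j a (suc w) + q ^ e * qbinom a (suc j)) (sym (*-suc (suc j) w)) ⟩
      hockeyStick j a (suc w) + q ^ (suc j * suc w) * qbinom a (suc j)
    ∎
    where
    open ≡-Reasoning
    Q : ℕ
    Q = q ^ suc j
    regroup : ∀ g p h r x → g + p * (h + r * x) ≡ (g + p * h) + p * r * x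
    regroup = solve-∀

  -- The gap in hockeyStick+defect, given by a recursion rather than a (truncated) difference
  -- so that lower bounds can be read off its last terms.
  hockeyStickDefect : ℕ → ℕ → ℕ → ℕ
  hockeyStickDefect c a zero    = 0
  hockeyStickDefect c a (suc w) =
    q ^ suc (suc c) * hockeyStickDefect c a w + q * [ suc w ] * qbinom (w + a) c

  hockeyStick+defect : ∀ c a w →
    hockeyStick (suc c) a (suc w) + hockeyStickDefect c a w ≡ [ suc w ] * qbinom (w + a) (suc c)
  hockeyStick+defect c a zero = base q (qbinom a (suc c)) (q ^ suc (suc c))
    where
    base : ∀ q g p → g + p * 0 + 0 ≡ (1 + q * 0) * g
    base = solve-∀
  hockeyStick+defect c a (suc w) = begin
      (Z + P * hockeyStick (suc c) a (suc w)) + (P * hockeyStickDefect c a w + q * R * Y)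
    ≡⟨ regroup Z P (hockeyStick (suc c) a (suc w)) (hockeyStickDefect c a w) (q * R * Y) ⟩
      Z + P * (hockeyStick (suc c) a (suc w) + hockeyStickDefect c a w) + q * R * Y
    ≡⟨ cong (λ x → Z + P * x + q * R * Y) (hockeyStick+defect c a w) ⟩
      Z + P * (R * X) + q * R * Y
    ≡⟨ pascal Y X (q ^ suc c) q R ⟩
      (1 + q * R) * Z
    ∎
    where
    open ≡-Reasoning
    R X Y Z P : ℕ
    R = [ suc w ]
    X = qbinom (w + a) (suc c)
    Y = qbinom (w + a) c
    Z = qbinom (suc w + a) (suc c)
    P = q ^ suc (suc c)
    regroup : ∀ z p s d r → (z + p * s) + (p * d + r) ≡ z + p * (s + d) + r
    regroup = solve-∀
    pascal : ∀ y x p q r → (y + p * x) + (q * p) * (r * x) + q * r * y ≡ (1 + q * r) * (y + p * x)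
    pascal = solve-∀

  prodUpTo-shift : ∀ j (f : ℕ → ℕ) → prodUpTo (suc j) f ≡ f 0 * prodUpTo j (λ i → f (suc i))
  prodUpTo-shift zero    f = *-comm 1 (f 0)
  prodUpTo-shift (suc j) f = begin
      prodUpTo (suc j) f * f (suc j)                         ≡⟨ cong (_* f (suc j)) (prodUpTo-shift j f) ⟩
      f 0 * prodUpTo j (λ i → f (suc i)) * f (suc j)         ≡⟨ *-assoc (f 0) _ _ ⟩
      f 0 * (prodUpTo j (λ i → f (suc i)) * f (suc j))       ∎
    where open ≡-Reasoning

  numerator : ℕ → ℕ → ℕ
  numerator N j = prodUpTo j (λ i → q ^ (N ∸ i) ∸ 1)

  numerator-suc : ∀ N j → numerator (suc N) (suc j) ≡ (q ^ suc N ∸ 1) * numerator N j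
  numerator-suc N j = prodUpTo-shift j (λ i → q ^ (suc N ∸ i) ∸ 1)

  numerator≡0 : ∀ {N j} → N < j → numerator N j ≡ 0
  numerator≡0 {N} {suc j} N<1+j with m≤n⇒m<n∨m≡n (s≤s⁻¹ N<1+j)
  ... | inj₁ N<j  = cong (_* (q ^ (N ∸ j) ∸ 1)) (numerator≡0 N<j)
  ... | inj₂ refl = trans (cong (λ e → numerator N N * (q ^ e ∸ 1)) (n∸n≡0 N)) (*-zeroʳ (numerator N N))

  div-cancelʳ : ∀ x {d} → 1 ≤ d → (x * d) div d ≡ x
  div-cancelʳ x {suc d} _ = m*n/n≡m x (suc d)

  module Properties (q≥2 : 2 ≤ q) where

    instance
      q-nonZero : NonZero q
      q-nonZero = >-nonZero (≤-trans (s≤s z≤n) q≥2)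

    2≤q^[1+x] : ∀ x → 2 ≤ q ^ suc x
    2≤q^[1+x] x = *-mono-≤ q≥2 (m^n>0 q x)

    [w]<q^w : ∀ w → [ w ] < q ^ w
    [w]<q^w zero    = s≤s z≤n
    [w]<q^w (suc w) = begin-strict
        1 + q * [ w ]    <⟨ +-monoˡ-< (q * [ w ]) q≥2 ⟩
        q + q * [ w ]    ≡⟨ sym (*-suc q [ w ]) ⟩
        q * suc [ w ]    ≤⟨ *-monoʳ-≤ q ([w]<q^w w) ⟩
        q * q ^ w        ∎
      where open ≤-Reasoning

    numerator-pascal : ∀ N j → (q ^ suc j ∸ 1) * numerator N j + q ^ suc j * numerator N (suc j)
                               ≡ (q ^ suc N ∸ 1) * numerator N j
    numerator-pascal N j with j ≤? N
    ... | yes j≤N =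
      trans ([x∸1]*p+x*[p*[y∸1]]≡[x*y∸1]*p (numerator N j) (m^n>0 q (suc j)) (m^n>0 q (N ∸ j)))
            (cong (λ x → (x ∸ 1) * numerator N j) q^[1+j]*q^[N∸j]≡q^[1+N])
      where
      [x∸1]*p+x*[p*[y∸1]]≡[x*y∸1]*p : ∀ {x y} p → 1 ≤ x → 1 ≤ y →
        (x ∸ 1) * p + x * (p * (y ∸ 1)) ≡ (x * y ∸ 1) * p
      [x∸1]*p+x*[p*[y∸1]]≡[x*y∸1]*p {suc x} {suc y} p _ _ = identity x y p
        where
        identity : ∀ x y p → x * p + suc x * (p * y) ≡ (y + x * suc y) * p
        identity = solve-∀
      q^[1+j]*q^[N∸j]≡q^[1+N] : q ^ suc j * q ^ (N ∸ j) ≡ q ^ suc N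
      q^[1+j]*q^[N∸j]≡q^[1+N] = trans (sym (^-distribˡ-+-* q (suc j) (N ∸ j)))
                                      (cong (λ e → q ^ suc e) (m+[n∸m]≡n j≤N))
    ... | no j≰N rewrite numerator≡0 (≰⇒> j≰N)
                       | *-zeroʳ (q ^ suc j ∸ 1) | *-zeroʳ (q ^ suc j) | *-zeroʳ (q ^ suc N ∸ 1) = refl

    qbinom*numerator : ∀ N j → qbinom N j * numerator j j ≡ numerator N j
    qbinom*numerator N       zero    = refl
    qbinom*numerator zero    (suc j) = sym (numerator≡0 {0} {suc j} (s≤s z≤n))
    qbinom*numerator (suc N) (suc j) = begin
        (G₀ + Q * G₁) * numerator (suc j) (suc j)
      ≡⟨ cong ((G₀ + Q * G₁) *_) (numerator-suc j j) ⟩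
        (G₀ + Q * G₁) * ((Q ∸ 1) * numerator j j)
      ≡⟨ distribute G₀ Q G₁ (Q ∸ 1) (numerator j j) ⟩
        (Q ∸ 1) * (G₀ * numerator j j) + Q * (G₁ * ((Q ∸ 1) * numerator j j))
      ≡⟨ cong₂ (λ x z → (Q ∸ 1) * x + Q * (G₁ * z)) (qbinom*numerator N j) (sym (numerator-suc j j)) ⟩
        (Q ∸ 1) * numerator N j + Q * (G₁ * numerator (suc j) (suc j))
      ≡⟨ cong (λ x → (Q ∸ 1) * numerator N j + Q * x) (qbinom*numerator N (suc j)) ⟩
        (Q ∸ 1) * numerator N j + Q * numerator N (suc j)
      ≡⟨ numerator-pascal N j ⟩
        (q ^ suc N ∸ 1) * numerator N j
      ≡⟨ sym (numerator-suc N j) ⟩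
        numerator (suc N) (suc j)
      ∎
      where
      open ≡-Reasoning
      Q G₀ G₁ : ℕ
      Q  = q ^ suc j
      G₀ = qbinom N j
      G₁ = qbinom N (suc j)
      distribute : ∀ g p h x d → (g + p * h) * (x * d) ≡ x * (g * d) + p * (h * (x * d))
      distribute = solve-∀

    1≤numerator[j,j] : ∀ j → 1 ≤ numerator j j
    1≤numerator[j,j] zero    = ≤-refl
    1≤numerator[j,j] (suc j) = subst (1 ≤_) (sym (numerator-suc j j))
                                     (*-mono-≤ (∸-monoˡ-≤ 1 (2≤q^[1+x] j)) (1≤numerator[j,j] j))

    gauss≡qbinom : ∀ N j → gauss q N j ≡ qbinom N j
    gauss≡qbinom N j = trans (cong (_div numerator j j) (sym (qbinom*numerator N j)))
                             (div-cancelʳ (qbinom N j) (1≤numerator[j,j] j))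

    qbinom*[q^[1+j]∸1]*numerator : ∀ N j →
      qbinom N (suc j) * (q ^ suc j ∸ 1) * numerator j j ≡ numerator N (suc j)
    qbinom*[q^[1+j]∸1]*numerator N j = begin
        qbinom N (suc j) * (q ^ suc j ∸ 1) * numerator j j
      ≡⟨ *-assoc (qbinom N (suc j)) (q ^ suc j ∸ 1) (numerator j j) ⟩
        qbinom N (suc j) * ((q ^ suc j ∸ 1) * numerator j j)
      ≡⟨ cong (qbinom N (suc j) *_) (sym (numerator-suc j j)) ⟩
        qbinom N (suc j) * numerator (suc j) (suc j)
      ≡⟨ qbinom*numerator N (suc j) ⟩
        numerator N (suc j)
      ∎
      where open ≡-Reasoning

    qbinom-absorb : ∀ j a →
      qbinom (suc j + a) (suc j) * (q ^ suc j ∸ 1) ≡ qbinom (suc j + a) j * (q ^ suc a ∸ 1)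
    qbinom-absorb j a = *-cancelʳ-≡ _ _ (numerator j j) {{>-nonZero (1≤numerator[j,j] j)}} (begin
        qbinom N (suc j) * (q ^ suc j ∸ 1) * numerator j j
      ≡⟨ qbinom*[q^[1+j]∸1]*numerator N j ⟩
        numerator N j * (q ^ (N ∸ j) ∸ 1)
      ≡⟨ cong₂ (λ x e → x * (q ^ e ∸ 1)) (sym (qbinom*numerator N j)) N∸j≡1+a ⟩
        qbinom N j * numerator j j * (q ^ suc a ∸ 1)
      ≡⟨ swap (qbinom N j) (numerator j j) (q ^ suc a ∸ 1) ⟩
        qbinom N j * (q ^ suc a ∸ 1) * numerator j j
      ∎)
      where
      open ≡-Reasoning
      N : ℕ
      N = suc j + a
      N∸j≡1+a : N ∸ j ≡ suc a
      N∸j≡1+a = trans (cong (_∸ j) (sym (+-suc j a))) (m+n∸m≡n j (suc a))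
      swap : ∀ x y z → x * y * z ≡ x * z * y
      swap = solve-∀

    qbinom-absorb-suc : ∀ N j → qbinom (suc N) (suc j) * (q ^ suc j ∸ 1) ≡ (q ^ suc N ∸ 1) * qbinom N j
    qbinom-absorb-suc N j = *-cancelʳ-≡ _ _ (numerator j j) {{>-nonZero (1≤numerator[j,j] j)}} (begin
        qbinom (suc N) (suc j) * (q ^ suc j ∸ 1) * numerator j j
      ≡⟨ qbinom*[q^[1+j]∸1]*numerator (suc N) j ⟩
        numerator (suc N) (suc j)
      ≡⟨ numerator-suc N j ⟩
        (q ^ suc N ∸ 1) * numerator N j
      ≡⟨ cong ((q ^ suc N ∸ 1) *_) (sym (qbinom*numerator N j)) ⟩
        (q ^ suc N ∸ 1) * (qbinom N j * numerator j j)
      ≡⟨ sym (*-assoc (q ^ suc N ∸ 1) (qbinom N j) (numerator j j)) ⟩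
        (q ^ suc N ∸ 1) * qbinom N j * numerator j j
      ∎)
      where open ≡-Reasoning

    qbinom-≤-suc : ∀ j a → j ≤ a → qbinom (suc j + a) j ≤ qbinom (suc j + a) (suc j)
    qbinom-≤-suc j a j≤a = *-cancelʳ-≤ _ _ (q ^ suc j ∸ 1) {{>-nonZero 1≤q^[1+j]∸1}} (begin
        qbinom (suc j + a) j * (q ^ suc j ∸ 1)
      ≤⟨ *-monoʳ-≤ (qbinom (suc j + a) j) (∸-monoˡ-≤ 1 (^-monoʳ-≤ q (s≤s j≤a))) ⟩
        qbinom (suc j + a) j * (q ^ suc a ∸ 1)
      ≡⟨ sym (qbinom-absorb j a) ⟩
        qbinom (suc j + a) (suc j) * (q ^ suc j ∸ 1)
      ∎)
      where
      open ≤-Reasoning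
      1≤q^[1+j]∸1 : 1 ≤ q ^ suc j ∸ 1
      1≤q^[1+j]∸1 = ∸-monoˡ-≤ 1 (2≤q^[1+x] j)

    qbinom[1+j+a,j]≤2*q^j*qbinom[j+a,j] : ∀ j a → j ≤ suc a →
      qbinom (suc (j + a)) j ≤ 2 * (q ^ j * qbinom (j + a) j)
    qbinom[1+j+a,j]≤2*q^j*qbinom[j+a,j] zero    a _         = s≤s z≤n
    qbinom[1+j+a,j]≤2*q^j*qbinom[j+a,j] (suc j) a (s≤s j≤a) = begin
        qbinom (suc j + a) j + p * H  ≤⟨ +-monoˡ-≤ (p * H) (≤-trans (qbinom-≤-suc j a j≤a) H≤p*H) ⟩
        p * H + p * H                 ≡⟨ cong (p * H +_) (sym (+-identityʳ (p * H))) ⟩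
        2 * (p * H)                   ∎
      where
      open ≤-Reasoning
      p H : ℕ
      p = q ^ suc j
      H = qbinom (suc j + a) (suc j)
      H≤p*H : H ≤ p * H
      H≤p*H = m≤n*m H p {{>-nonZero (m^n>0 q (suc j))}}

    q^[1+a]≤qbinom[1+j+a,j] : ∀ j a → 1 ≤ j → q ^ suc a ≤ qbinom (suc j + a) j
    q^[1+a]≤qbinom[1+j+a,j] (suc zero)    a _ =
      subst (q ^ suc a ≤_) (sym (qbinom[N,1]≡[N] (suc (suc a)))) (q^w≤[1+w] (suc a))
    q^[1+a]≤qbinom[1+j+a,j] (suc (suc j)) a _ =
      ≤-trans (q^[1+a]≤qbinom[1+j+a,j] (suc j) a (s≤s z≤n)) (m≤m+n _ _)

module Arithmetic where
  open import Data.Nat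
  open import Data.Nat.Properties
  open import Data.Nat.Tactic.RingSolver using (solve-∀)
  open import Relation.Binary.PropositionalEquality

  v*c≤a⇒v*[a+c]<[v+s]*[a+s⊓c] : ∀ {v a c s} → v * c ≤ a → 1 ≤ s → 1 ≤ c →
    v * (a + c) < (v + s) * (a + s ⊓ c)
  v*c≤a⇒v*[a+c]<[v+s]*[a+s⊓c] {v} {a} {c} {s} v*c≤a 1≤s 1≤c = begin-strict
      v * (a + c)        ≡⟨ *-distribˡ-+ v a c ⟩
      v * a + v * c      ≤⟨ +-monoʳ-≤ (v * a) v*c≤a ⟩
      v * a + a          <⟨ s≤s (m≤m+n (v * a + a) v) ⟩
      suc (v * a + a + v) ≡⟨ expand v a ⟩
      (v + 1) * (a + 1)  ≤⟨ *-mono-≤ (+-monoʳ-≤ v 1≤s) (+-monoʳ-≤ a (⊓-glb 1≤s 1≤c)) ⟩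
      (v + s) * (a + s ⊓ c) ∎
    where
    open ≤-Reasoning
    expand : ∀ v a → suc (v * a + a + v) ≡ (v + 1) * (a + 1)
    expand = solve-∀

  -- Multiplying the two relations gives (v−1)(y−1) D² = (vy−1)(u−1) F E, and (vy−1)(u−1) ≤ v u (y−1)
  -- as u ≤ y; finally 3v ≤ 4(v−1) as v ≥ 4.
  3*D*D≤4*u*F*E : ∀ {u v y D E F} → 2 ≤ u → u ≤ y → 4 ≤ v →
    E * (u ∸ 1) ≡ D * (y ∸ 1) → D * (v ∸ 1) ≡ (v * y ∸ 1) * F → 3 * (D * D) ≤ 4 * (u * F * E)
  3*D*D≤4*u*F*E {suc u₁} {suc v₁} {suc y₁} {D} {E} {F} (s≤s 1≤u₁) (s≤s u₁≤y₁) (s≤s 3≤v₁)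
                E*u₁≡D*y₁ D*v₁≡K*F =
    *-cancelʳ-≤ (3 * (D * D)) (4 * (u * F * E)) (suc v₁) (begin
      3 * (D * D) * suc v₁           ≡⟨ *-comm (3 * (D * D)) (suc v₁) ⟩
      suc v₁ * (3 * (D * D))         ≡⟨ sym (*-assoc (suc v₁) 3 (D * D)) ⟩
      suc v₁ * 3 * (D * D)           ≤⟨ *-monoˡ-≤ (D * D) [1+v₁]*3≤4*v₁ ⟩
      4 * v₁ * (D * D)               ≡⟨ *-assoc 4 v₁ (D * D) ⟩
      4 * (v₁ * (D * D))             ≤⟨ *-monoʳ-≤ 4 v₁*D*D≤v*u*F*E ⟩
      4 * (suc v₁ * u * (F * E))     ≡⟨ regroup v₁ u F E ⟩
      4 * (u * F * E) * suc v₁       ∎)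
    where
    open ≤-Reasoning
    u K : ℕ
    u = suc u₁
    K = y₁ + v₁ * suc y₁
    [1+v₁]*3≤4*v₁ : suc v₁ * 3 ≤ 4 * v₁
    [1+v₁]*3≤4*v₁ = subst₂ _≤_ (split₁ v₁) (split₂ v₁) (+-monoˡ-≤ (3 * v₁) 3≤v₁)
      where
      split₁ : ∀ v₁ → 3 + 3 * v₁ ≡ suc v₁ * 3
      split₁ = solve-∀
      split₂ : ∀ v₁ → v₁ + 3 * v₁ ≡ 4 * v₁
      split₂ = solve-∀
    u₁*K≤v*u*y₁ : u₁ * K ≤ suc v₁ * u * y₁
    u₁*K≤v*u*y₁ = begin
        u₁ * K                                   ≡⟨ expand u₁ y₁ v₁ ⟩
        u₁ * y₁ + u₁ * v₁ * y₁ + u₁ * v₁         ≤⟨ +-monoʳ-≤ (u₁ * y₁ + u₁ * v₁ * y₁) u₁*v₁≤y₁+y₁*v₁ ⟩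
        u₁ * y₁ + u₁ * v₁ * y₁ + (y₁ + y₁ * v₁)  ≡⟨ collect u₁ y₁ v₁ ⟩
        suc v₁ * u * y₁                          ∎
      where
      u₁*v₁≤y₁+y₁*v₁ : u₁ * v₁ ≤ y₁ + y₁ * v₁
      u₁*v₁≤y₁+y₁*v₁ = ≤-trans (*-monoˡ-≤ v₁ u₁≤y₁) (m≤n+m (y₁ * v₁) y₁)
      expand : ∀ u₁ y₁ v₁ → u₁ * (y₁ + v₁ * suc y₁) ≡ u₁ * y₁ + u₁ * v₁ * y₁ + u₁ * v₁
      expand = solve-∀
      collect : ∀ u₁ y₁ v₁ → u₁ * y₁ + u₁ * v₁ * y₁ + (y₁ + y₁ * v₁) ≡ suc v₁ * suc u₁ * y₁
      collect = solve-∀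
    v₁*D*D≤v*u*F*E : v₁ * (D * D) ≤ suc v₁ * u * (F * E)
    v₁*D*D≤v*u*F*E = *-cancelʳ-≤ _ _ y₁ {{>-nonZero (≤-trans 1≤u₁ u₁≤y₁)}} (begin
        v₁ * (D * D) * y₁                ≡⟨ pair v₁ D y₁ ⟩
        (D * v₁) * (D * y₁)              ≡⟨ cong₂ _*_ D*v₁≡K*F (sym E*u₁≡D*y₁) ⟩
        (K * F) * (E * u₁)               ≡⟨ unpair K F E u₁ ⟩
        u₁ * K * (F * E)                 ≤⟨ *-monoˡ-≤ (F * E) u₁*K≤v*u*y₁ ⟩
        suc v₁ * u * y₁ * (F * E)        ≡⟨ swap (suc v₁ * u) y₁ (F * E) ⟩
        suc v₁ * u * (F * E) * y₁        ∎)
      where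
      pair : ∀ v₁ D y₁ → v₁ * (D * D) * y₁ ≡ (D * v₁) * (D * y₁)
      pair = solve-∀
      unpair : ∀ K F E u₁ → (K * F) * (E * u₁) ≡ u₁ * K * (F * E)
      unpair = solve-∀
      swap : ∀ x y z → x * y * z ≡ x * z * y
      swap = solve-∀
    regroup : ∀ v₁ u F E → 4 * (suc v₁ * u * (F * E)) ≡ 4 * (u * F * E) * suc v₁
    regroup = solve-∀

module Estimates {q : ℕ} (q≥2 : 2 ℕ.≤ q) (c a : ℕ) (m≤a : suc (suc c) ℕ.≤ a) where
  open import Data.Nat
  open import Data.Nat.Properties
  open import Data.Nat.Tactic.RingSolver using (solve-∀)
  open import Data.Sum using (inj₁; inj₂)
  open import Relation.Binary.PropositionalEquality hiding ([_])
  open QBinomial q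
  open Properties q≥2
  open Arithmetic

  b m : ℕ
  b = suc c
  m = suc b

  u v y : ℕ
  u = q ^ m
  v = q ^ b
  y = q ^ suc a

  -- With m = k − t and a = n − k − 1: A = [n−t, k−t], B = q^((k−t)(k+1−t)) [n−k−1, k−t],
  -- D = [n−t−1, k−t−1], E = [n−t−1, k−t], C t = q^(k−t+1) [t, 1], and V = A − B.
  A B V D E Δ : ℕ
  A = qbinom (suc m + a) m
  B = q ^ (m * suc m) * qbinom a m
  V = hockeyStick b a (suc m)
  D = qbinom (m + a) b
  E = qbinom (m + a) m
  Δ = hockeyStickDefect c a m

  C : ℕ → ℕ
  C t = q ^ suc m * [ t ]

  A≡V+B : A ≡ V + B
  A≡V+B = qbinom-hockeyStick b a (suc m)

  V≤[1+m]*D : V ≤ [ suc m ] * D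
  V≤[1+m]*D = subst (V ≤_) (hockeyStick+defect c a m) (m≤m+n V Δ)

  D≤E : D ≤ E
  D≤E = qbinom-≤-suc b a (≤-trans (n≤1+n b) m≤a)

  y≤D : y ≤ D
  y≤D = q^[1+a]≤qbinom[1+j+a,j] b a (s≤s z≤n)

  1≤D : 1 ≤ D
  1≤D = ≤-trans (m^n>0 q (suc a)) y≤D

  1≤E : 1 ≤ E
  1≤E = ≤-trans 1≤D D≤E

  1≤D*E : 1 ≤ D * E
  1≤D*E = *-mono-≤ 1≤D 1≤E

  u≤y : u ≤ y
  u≤y = ^-monoʳ-≤ q (≤-trans m≤a (n≤1+n a))

  [y∸1]*D≤u*E : (y ∸ 1) * D ≤ u * E
  [y∸1]*D≤u*E = begin
      (y ∸ 1) * D    ≡⟨ *-comm (y ∸ 1) D ⟩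
      D * (y ∸ 1)    ≡⟨ sym (qbinom-absorb b a) ⟩
      E * (u ∸ 1)    ≤⟨ *-monoʳ-≤ E (m∸n≤m u 1) ⟩
      E * u          ≡⟨ *-comm E u ⟩
      u * E          ∎
    where open ≤-Reasoning

  W : ℕ → ℕ
  W s = V + A + s

  W≤2*q*u*E : ∀ {s} → s ≤ E → W s ≤ 2 * (q * u * E)
  W≤2*q*u*E {s} s≤E = begin
      V + (D + u * E) + s               ≤⟨ +-mono-≤ (+-mono-≤ V≤q*u*E (+-monoˡ-≤ (u * E) D≤E)) s≤E ⟩
      q * u * E + (E + u * E) + E       ≡⟨ collect (q * u) u E ⟩
      (q * u + (u + 2)) * E             ≤⟨ *-monoˡ-≤ E (+-monoʳ-≤ (q * u) u+2≤q*u) ⟩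
      (q * u + q * u) * E               ≡⟨ double (q * u) E ⟩
      2 * (q * u * E)                   ∎
    where
    open ≤-Reasoning
    V≤q*u*E : V ≤ q * u * E
    V≤q*u*E = ≤-trans V≤[1+m]*D (*-mono-≤ (<⇒≤ ([w]<q^w (suc m))) D≤E)
    u+2≤q*u : u + 2 ≤ q * u
    u+2≤q*u = begin
        u + 2          ≤⟨ +-monoʳ-≤ u (2≤q^[1+x] b) ⟩
        u + u          ≡⟨ cong (u +_) (sym (+-identityʳ u)) ⟩
        2 * u          ≤⟨ *-monoˡ-≤ u q≥2 ⟩
        q * u          ∎
    collect : ∀ Q u E → Q * E + (E + u * E) + E ≡ (Q + (u + 2)) * E
    collect = solve-∀
    double : ∀ Q E → (Q + Q) * E ≡ 2 * (Q * E)
    double = solve-∀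

  V*C≤A : ∀ t → m + m + t + 2 ≤ a → V * C t ≤ A
  V*C≤A t size = begin
      V * (q ^ suc m * [ t ])
    ≤⟨ *-mono-≤ V≤[1+m]*D (*-monoʳ-≤ (q ^ suc m) (<⇒≤ ([w]<q^w t))) ⟩
      [ suc m ] * D * (q ^ suc m * q ^ t)
    ≤⟨ *-monoˡ-≤ (q ^ suc m * q ^ t) (*-monoˡ-≤ D (<⇒≤ ([w]<q^w (suc m)))) ⟩
      q ^ suc m * D * (q ^ suc m * q ^ t)
    ≡⟨ regroup (q ^ suc m) D (q ^ t) ⟩
      q ^ suc m * q ^ suc m * q ^ t * D
    ≡⟨ cong (_* D) (sym q^[2m+2+t]) ⟩
      q ^ (suc m + suc m + t) * D
    ≤⟨ *-monoˡ-≤ D (∸-monoˡ-≤ 1 (^-monoʳ-< q q≥2 exponent<1+a)) ⟩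
      (y ∸ 1) * D
    ≤⟨ [y∸1]*D≤u*E ⟩
      u * E
    ≤⟨ m≤n+m (u * E) D ⟩
      A
    ∎
    where
    open ≤-Reasoning
    regroup : ∀ x d z → x * d * (x * z) ≡ x * x * z * d
    regroup = solve-∀
    q^[2m+2+t] : q ^ (suc m + suc m + t) ≡ q ^ suc m * q ^ suc m * q ^ t
    q^[2m+2+t] = trans (^-distribˡ-+-* q (suc m + suc m) t)
                       (cong (_* q ^ t) (^-distribˡ-+-* q (suc m) (suc m)))
    exponent<1+a : suc m + suc m + t < suc a
    exponent<1+a = s≤s (subst (_≤ a) (shift m t) size)
      where
      shift : ∀ m t → m + m + t + 2 ≡ suc m + suc m + t
      shift = solve-∀

  gain : ∀ t s → 1 ≤ t → 1 ≤ s → m + m + t + 2 ≤ a → V * (A + C t) < (V + s) * (A + s ⊓ C t)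
  gain (suc t) s _ 1≤s size =
    v*c≤a⇒v*[a+c]<[v+s]*[a+s⊓c] {V} {A} {C (suc t)} (V*C≤A (suc t) size) 1≤s
                                  (*-mono-≤ (m^n>0 q (suc m)) (s≤s z≤n))

  g₁-reduction : ∀ s Z → q * [ m ] * (D * D) + s * W s < Z + Δ * (u * E) →
    (V + s) * (A + s) < D * D + u * [ suc m ] * D * E + Z
  g₁-reduction s Z key = +-cancelʳ-< (Δ * (u * E)) _ _ (begin-strict
      (V + s) * (A + s) + Δ * (u * E)
    ≡⟨ expand V s D (u * E) Δ ⟩
      V * D + (V + Δ) * (u * E) + s * W s
    ≡⟨ cong (λ x → V * D + x * (u * E) + s * W s) (hockeyStick+defect c a m) ⟩
      V * D + [ suc m ] * D * (u * E) + s * W s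
    ≤⟨ +-monoˡ-≤ (s * W s) (+-monoˡ-≤ ([ suc m ] * D * (u * E)) (*-monoˡ-≤ D V≤[1+m]*D)) ⟩
      [ suc m ] * D * D + [ suc m ] * D * (u * E) + s * W s
    ≡⟨ collect q [ m ] D u E (s * W s) ⟩
      D * D + u * [ suc m ] * D * E + (q * [ m ] * (D * D) + s * W s)
    <⟨ +-monoʳ-< (D * D + u * [ suc m ] * D * E) key ⟩
      D * D + u * [ suc m ] * D * E + (Z + Δ * (u * E))
    ≡⟨ sym (+-assoc (D * D + u * [ suc m ] * D * E) Z (Δ * (u * E))) ⟩
      D * D + u * [ suc m ] * D * E + Z + Δ * (u * E)
    ∎)
    where
    open ≤-Reasoning
    expand : ∀ V s D x Δ → (V + s) * ((D + x) + s) + Δ * x ≡ V * D + (V + Δ) * x + s * (V + (D + x) + s)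
    expand = solve-∀
    collect : ∀ q r D u E w → (1 + q * r) * D * D + (1 + q * r) * D * (u * E) + w
                              ≡ D * D + u * (1 + q * r) * D * E + (q * r * (D * D) + w)
    collect = solve-∀

  g₁≤[V+s]*[A+s] : ∀ s x → (V + s) * (A + s ⊓ x) ≤ (V + s) * (A + s)
  g₁≤[V+s]*[A+s] s x = *-monoʳ-≤ (V + s) (+-monoʳ-≤ A (m⊓n≤m s x))

  excess<u*q*u*D*E : ∀ s → 13 * s ≤ y → q * [ m ] * (D * D) + s * W s < u * (q * u) * D * E
  excess<u*q*u*D*E s small = begin-strict
      q * [ m ] * (D * D) + s * W s
    ≤⟨ +-mono-≤ (*-monoʳ-≤ (q * [ m ]) (*-monoʳ-≤ D D≤E))
                (*-mono-≤ s≤D (W≤2*q*u*E (≤-trans s≤D D≤E))) ⟩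
      q * [ m ] * (D * E) + D * (2 * (q * u * E))
    ≡⟨ cong (q * [ m ] * (D * E) +_) (regroup D (q * u) E) ⟩
      q * [ m ] * (D * E) + 2 * (q * u * (D * E))
    <⟨ +-monoˡ-< (2 * (q * u * (D * E))) (*-monoˡ-< (D * E) {{>-nonZero 1≤D*E}} (*-monoʳ-< q ([w]<q^w m))) ⟩
      q * u * (D * E) + 2 * (q * u * (D * E))
    ≡⟨ triple (q * u * (D * E)) ⟩
      3 * (q * u * (D * E))
    <⟨ *-monoˡ-< (q * u * (D * E)) {{>-nonZero (*-mono-≤ (m^n>0 q (suc m)) 1≤D*E)}} 3<u ⟩
      u * (q * u * (D * E))
    ≡⟨ reassociate u (q * u) D E ⟩
      u * (q * u) * D * E
    ∎
    where
    open ≤-Reasoning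
    s≤D : s ≤ D
    s≤D = ≤-trans (m≤m+n s (12 * s)) (≤-trans small y≤D)
    3<u : 3 < u
    3<u = *-mono-≤ q≥2 (2≤q^[1+x] c)
    regroup : ∀ D Q E → D * (2 * (Q * E)) ≡ 2 * (Q * (D * E))
    regroup = solve-∀
    triple : ∀ x → x + 2 * x ≡ 3 * x
    triple = solve-∀
    reassociate : ∀ u Q D E → u * (Q * (D * E)) ≡ u * Q * D * E
    reassociate = solve-∀

  bound-m<t : ∀ t s → 13 * s ≤ y → m < t → (V + s) * (A + s) < u * [ suc t ] * D * E + D * D
  bound-m<t t s small m<t = begin-strict
      (V + s) * (A + s)
    <⟨ g₁-reduction s (u * (q * u) * D * E) (≤-trans (excess<u*q*u*D*E s small) (m≤m+n _ (Δ * (u * E)))) ⟩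
      D * D + u * [ suc m ] * D * E + u * (q * u) * D * E
    ≡⟨ collect D u [ suc m ] E (q * u) ⟩
      u * ([ suc m ] + q * u) * D * E + D * D
    ≡⟨ cong (λ x → u * x * D * E + D * D) (sym ([1+w]≡[w]+q^w (suc m))) ⟩
      u * [ suc (suc m) ] * D * E + D * D
    ≤⟨ +-monoˡ-≤ (D * D) (*-monoˡ-≤ E (*-monoˡ-≤ D (*-monoʳ-≤ u ([]-mono-≤ (s≤s m<t))))) ⟩
      u * [ suc t ] * D * E + D * D
    ∎
    where
    open ≤-Reasoning
    collect : ∀ D u r E Q → D * D + u * r * D * E + u * Q * D * E ≡ u * (r + Q) * D * E + D * D
    collect = solve-∀

  module _ (1≤c : 1 ≤ c) where

    p F H X : ℕ
    p = q ^ c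
    F = qbinom (suc c + a) c
    H = qbinom (c + a) c
    X = u * F * E

    y≤F : y ≤ F
    y≤F = q^[1+a]≤qbinom[1+j+a,j] c a 1≤c

    1≤X : 1 ≤ X
    1≤X = *-mono-≤ (*-mono-≤ (m^n>0 q m) (≤-trans (m^n>0 q (suc a)) y≤F)) 1≤E

    F≤2*p*H : F ≤ 2 * (p * H)
    F≤2*p*H = qbinom[1+j+a,j]≤2*q^j*qbinom[j+a,j] c a (≤-trans (m≤n+m c 2) (≤-trans m≤a (n≤1+n a)))

    u*v*H+q*[m]*F≤Δ : u * (v * H) + q * [ m ] * F ≤ Δ
    u*v*H+q*[m]*F≤Δ = +-monoˡ-≤ (q * [ m ] * F) (*-monoʳ-≤ u (≤-trans v*H≤q*[1+c]*H (m≤n+m _ _)))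
      where
      v*H≤q*[1+c]*H : v * H ≤ q * [ suc c ] * H
      v*H≤q*[1+c]*H = *-monoˡ-≤ H (*-monoʳ-≤ q (q^w≤[1+w] c))

    3*D*D≤4*X : 3 * (D * D) ≤ 4 * X
    3*D*D≤4*X =
      3*D*D≤4*u*F*E {u} {v} {y} {D} {E} {F} (2≤q^[1+x] b) u≤y 4≤v (qbinom-absorb b a) D*[v∸1]≡[v*y∸1]*F
      where
      4≤v : 4 ≤ v
      4≤v = *-mono-≤ q≥2 (≤-trans (subst (2 ≤_) (sym (*-identityʳ q)) q≥2) (^-monoʳ-≤ q 1≤c))
      q^[2+c+a]≡v*y : q ^ suc (suc c + a) ≡ v * y
      q^[2+c+a]≡v*y = trans (cong (λ e → q ^ suc e) (sym (+-suc c a))) (^-distribˡ-+-* q (suc c) (suc a))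
      D*[v∸1]≡[v*y∸1]*F : D * (v ∸ 1) ≡ (v * y ∸ 1) * F
      D*[v∸1]≡[v*y∸1]*F = trans (qbinom-absorb-suc (suc c + a) c) (cong (λ x → (x ∸ 1) * F) q^[2+c+a]≡v*y)

    2*q*[m]*X+q*X<3*q*u*X : 2 * (q * [ m ] * X) + q * X < 3 * (q * u * X)
    2*q*[m]*X+q*X<3*q*u*X = begin-strict
        2 * (q * [ m ] * X) + q * X    <⟨ +-mono-<-≤ (*-monoʳ-< 2 q*[m]*X<q*u*X) q*X≤q*u*X ⟩
        2 * (q * u * X) + q * u * X    ≡⟨ triple (q * u * X) ⟩
        3 * (q * u * X)                ∎
      where
      open ≤-Reasoning
      q*[m]*X<q*u*X : q * [ m ] * X < q * u * X
      q*[m]*X<q*u*X = *-monoˡ-< X {{>-nonZero 1≤X}} (*-monoʳ-< q ([w]<q^w m))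
      q*X≤q*u*X : q * X ≤ q * u * X
      q*X≤q*u*X = *-monoˡ-≤ X (m≤m*n q u {{>-nonZero (m^n>0 q m)}})
      triple : ∀ x → 2 * x + x ≡ 3 * x
      triple = solve-∀

    3*q*u*X≤6*u*v*H*u*E : 3 * (q * u * X) ≤ 6 * (u * (v * H) * (u * E))
    3*q*u*X≤6*u*v*H*u*E = begin
        3 * (q * u * (u * F * E))              ≤⟨ *-monoʳ-≤ 3 (*-monoʳ-≤ (q * u) (*-monoˡ-≤ E (*-monoʳ-≤ u F≤2*p*H))) ⟩
        3 * (q * u * (u * (2 * (p * H)) * E))  ≡⟨ regroup q u p H E ⟩
        6 * (u * (q * p * H) * (u * E))        ∎
      where
      open ≤-Reasoning
      regroup : ∀ q u p H E → 3 * (q * u * (u * (2 * (p * H)) * E)) ≡ 6 * (u * (q * p * H) * (u * E))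
      regroup = solve-∀

    excess<Δ*u*E : ∀ s → 13 * s ≤ y → q * [ m ] * (D * D) + s * W s < Δ * (u * E)
    excess<Δ*u*E s small = *-cancelˡ-< 6 _ _ (begin-strict
        6 * (r * (D * D) + s * W s)
      ≡⟨ split r (D * D) s (W s) ⟩
        2 * r * (3 * (D * D)) + 6 * s * W s
      ≤⟨ +-mono-≤ (*-monoʳ-≤ (2 * r) 3*D*D≤4*X) (*-monoʳ-≤ (6 * s) (W≤2*q*u*E s≤E)) ⟩
        2 * r * (4 * X) + 6 * s * (2 * (q * u * E))
      ≡⟨ regroup r X s (q * u * E) ⟩
        8 * (r * X) + 12 * s * (q * u * E)
      ≤⟨ +-monoʳ-≤ (8 * (r * X)) (*-monoˡ-≤ (q * u * E) 12*s≤F) ⟩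
        8 * (r * X) + F * (q * u * E)
      ≡⟨ extract-q r q u F E ⟩
        6 * (r * X) + (2 * (r * X) + q * X)
      <⟨ +-monoʳ-< (6 * (r * X)) 2*q*[m]*X+q*X<3*q*u*X ⟩
        6 * (r * X) + 3 * (q * u * X)
      ≤⟨ +-monoʳ-≤ (6 * (r * X)) 3*q*u*X≤6*u*v*H*u*E ⟩
        6 * (r * X) + 6 * (u * (v * H) * (u * E))
      ≡⟨ collect r u (v * H) F E ⟩
        6 * ((u * (v * H) + r * F) * (u * E))
      ≤⟨ *-monoʳ-≤ 6 (*-monoˡ-≤ (u * E) u*v*H+q*[m]*F≤Δ) ⟩
        6 * (Δ * (u * E))
      ∎)
      where
      open ≤-Reasoning
      r : ℕ
      r = q * [ m ]
      s≤E : s ≤ E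
      s≤E = ≤-trans (m≤m+n s (12 * s)) (≤-trans small (≤-trans y≤D D≤E))
      12*s≤F : 12 * s ≤ F
      12*s≤F = ≤-trans (*-monoˡ-≤ s (n≤1+n 12)) (≤-trans small y≤F)
      split : ∀ r d s w → 6 * (r * d + s * w) ≡ 2 * r * (3 * d) + 6 * s * w
      split = solve-∀
      regroup : ∀ r X s Y → 2 * r * (4 * X) + 6 * s * (2 * Y) ≡ 8 * (r * X) + 12 * s * Y
      regroup = solve-∀
      extract-q : ∀ r q u F E → 8 * (r * (u * F * E)) + F * (q * u * E)
                                ≡ 6 * (r * (u * F * E)) + (2 * (r * (u * F * E)) + q * (u * F * E))
      extract-q = solve-∀
      collect : ∀ r u w F E → 6 * (r * (u * F * E)) + 6 * (u * w * (u * E)) ≡ 6 * ((u * w + r * F) * (u * E))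
      collect = solve-∀

    bound-m≡t : ∀ s → 13 * s ≤ y → (V + s) * (A + s) < u * [ suc m ] * D * E + D * D
    bound-m≡t s small = subst ((V + s) * (A + s) <_) (trans (+-identityʳ _) (+-comm (D * D) _))
                              (g₁-reduction s 0 (excess<Δ*u*E s small))

  bound : ∀ t s → 13 * s ≤ y → m ≤ t → t ≢ 2 → (V + s) * (A + s ⊓ C t) < u * [ suc t ] * D * E + D * D
  bound t s small m≤t t≢2 with m≤n⇒m<n∨m≡n m≤t
  ... | inj₁ m<t  = ≤-<-trans (g₁≤[V+s]*[A+s] s (C t)) (bound-m<t t s small m<t)
  ... | inj₂ refl = ≤-<-trans (g₁≤[V+s]*[A+s] s (C m)) (bound-m≡t 1≤c s small)
    where
    1≤c : 1 ≤ c
    1≤c = n≢0⇒n>0 (λ c≡0 → t≢2 (cong (λ x → suc (suc x)) c≡0))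

module Reindexing {q n k t : ℕ} (q≥2 : 2 ℕ.≤ q) (1≤t : 1 ℕ.≤ t) (t+2≤k : t ℕ.+ 2 ℕ.≤ k)
                  (n-large : 3 ℕ.* k ℕ.+ 3 ℕ.* t ℕ.+ 1 ℕ.≤ n) where
  open import Data.Nat
  open import Data.Nat.Properties
  open import Data.Nat.Tactic.RingSolver using (solve-∀)
  open import Relation.Binary.PropositionalEquality hiding ([_])
  open QBinomial q
  open Properties q≥2

  c a m : ℕ
  c = k ∸ t ∸ 2
  a = n ∸ k ∸ 1
  m = 2 + c

  t≤k : t ≤ k
  t≤k = ≤-trans (m≤m+n t 2) t+2≤k

  k<n : k < n
  k<n = ≤-trans (subst (_≤ 3 * k + 3 * t + 1) (+-comm k 1) (+-monoˡ-≤ 1 k≤3k+3t)) n-large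
    where
    k≤3k+3t : k ≤ 3 * k + 3 * t
    k≤3k+3t = ≤-trans (m≤m+n k (2 * k)) (m≤m+n (3 * k) (3 * t))

  k∸t≡m : k ∸ t ≡ m
  k∸t≡m = sym (m+[n∸m]≡n (m+n≤o⇒m≤o∸n 2 (subst (_≤ k) (+-comm t 2) t+2≤k)))

  n∸k≡1+a : n ∸ k ≡ suc a
  n∸k≡1+a = sym (m+[n∸m]≡n (m<n⇒0<n∸m k<n))

  k≡m+t : k ≡ m + t
  k≡m+t = trans (sym (m∸n+n≡m t≤k)) (cong (_+ t) k∸t≡m)

  n≡1+a+k : n ≡ suc a + k
  n≡1+a+k = trans (sym (m∸n+n≡m (<⇒≤ k<n))) (cong (_+ k) n∸k≡1+a)

  n∸t≡1+m+a : n ∸ t ≡ suc m + a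
  n∸t≡1+m+a = begin
      n ∸ t              ≡⟨ cong (_∸ t) (sym (m∸n+n≡m (<⇒≤ k<n))) ⟩
      (n ∸ k + k) ∸ t    ≡⟨ +-∸-assoc (n ∸ k) t≤k ⟩
      n ∸ k + (k ∸ t)    ≡⟨ cong₂ _+_ n∸k≡1+a k∸t≡m ⟩
      suc a + m          ≡⟨ cong suc (+-comm a m) ⟩
      suc m + a          ∎
    where open ≡-Reasoning

  k+1∸t≡1+m : k + 1 ∸ t ≡ suc m
  k+1∸t≡1+m = trans (+-∸-comm 1 t≤k) (trans (cong (_+ 1) k∸t≡m) (+-comm m 1))

  m+m+t+2≤a : m + m + t + 2 ≤ a
  m+m+t+2≤a = size m t a 1≤t (subst (λ x → 3 * x + 3 * t + 1 ≤ suc a + x) k≡m+t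
                                    (subst (3 * k + 3 * t + 1 ≤_) n≡1+a+k n-large))
    where
    open ≤-Reasoning
    size : ∀ m t a → 1 ≤ t → 3 * (m + t) + 3 * t + 1 ≤ suc a + (m + t) → m + m + t + 2 ≤ a
    size m (suc t) a _ large = +-cancelʳ-≤ (m + suc t + 1) (m + m + suc t + 2) a (begin
        m + m + suc t + 2 + (m + suc t + 1)                 ≤⟨ m≤m+n _ (4 * t + 2) ⟩
        m + m + suc t + 2 + (m + suc t + 1) + (4 * t + 2)   ≡⟨ expand m t ⟩
        3 * (m + suc t) + 3 * suc t + 1                     ≤⟨ large ⟩
        suc a + (m + suc t)                                 ≡⟨ shift a m t ⟩
        a + (m + suc t + 1)                                 ∎)
      where
      expand : ∀ m t → m + m + suc t + 2 + (m + suc t + 1) + (4 * t + 2) ≡ 3 * (m + suc t) + 3 * suc t + 1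
      expand = solve-∀
      shift : ∀ a m t → suc a + (m + suc t) ≡ a + (m + suc t + 1)
      shift = solve-∀

  m≤a : m ≤ a
  m≤a = ≤-trans (≤-trans (m≤m+n m m) (≤-trans (m≤m+n (m + m) t) (m≤m+n (m + m + t) 2))) m+m+t+2≤a

  n∸[3k+3t+1]≤1+a : n ∸ (3 * k + 3 * t + 1) ≤ suc a
  n∸[3k+3t+1]≤1+a = subst (n ∸ (3 * k + 3 * t + 1) ≤_) n∸k≡1+a (∸-monoʳ-≤ n k≤3k+3t+1)
    where
    k≤3k+3t+1 : k ≤ 3 * k + 3 * t + 1
    k≤3k+3t+1 = ≤-trans (m≤m+n k (2 * k)) (≤-trans (m≤m+n (3 * k) (3 * t)) (m≤m+n (3 * k + 3 * t) 1))

  k≤2t⇒m≤t : k ≤ 2 * t → m ≤ t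
  k≤2t⇒m≤t k≤2t = +-cancelʳ-≤ t m t (subst₂ _≤_ k≡m+t (cong (t +_) (+-identityʳ t)) k≤2t)

  open Estimates q≥2 c a m≤a public using (V)
  open Estimates q≥2 c a m≤a using (u)
    renaming ( A to A′; B to B′; C to C′; D to D′; E to E′
             ; A≡V+B to A′≡V+B′; gain to gain′; bound to bound′)

  A B C D E X : ℕ
  A = gauss q (n ∸ t) (k ∸ t)
  B = q ^ ((k ∸ t) * (k + 1 ∸ t)) * gauss q (n ∸ k ∸ 1) (k ∸ t)
  C = q ^ (k ∸ t + 1) * gauss q t 1
  D = gauss q (n ∸ t ∸ 1) (k ∸ t ∸ 1)
  E = gauss q (n ∸ t ∸ 1) (k ∸ t)
  X = q ^ (k ∸ t) * gauss q (t + 1) 1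

  A≡A′ : A ≡ A′
  A≡A′ = trans (cong₂ (gauss q) n∸t≡1+m+a k∸t≡m) (gauss≡qbinom (suc m + a) m)

  B≡B′ : B ≡ B′
  B≡B′ = cong₂ _*_ (cong₂ (λ x z → q ^ (x * z)) k∸t≡m k+1∸t≡1+m)
                    (trans (cong (gauss q a) k∸t≡m) (gauss≡qbinom a m))

  C≡C′ : C ≡ C′ t
  C≡C′ = cong₂ _*_ (cong (q ^_) (trans (cong (_+ 1) k∸t≡m) (+-comm m 1)))
                    (trans (gauss≡qbinom t 1) (qbinom[N,1]≡[N] t))

  D≡D′ : D ≡ D′
  D≡D′ = trans (cong₂ (gauss q) (cong (_∸ 1) n∸t≡1+m+a) (cong (_∸ 1) k∸t≡m))
               (gauss≡qbinom (m + a) (suc c))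

  E≡E′ : E ≡ E′
  E≡E′ = trans (cong₂ (gauss q) (cong (_∸ 1) n∸t≡1+m+a) k∸t≡m) (gauss≡qbinom (m + a) m)

  X≡u*[1+t] : X ≡ u * [ suc t ]
  X≡u*[1+t] = cong₂ _*_ (cong (q ^_) k∸t≡m)
                        (trans (gauss≡qbinom (t + 1) 1) (trans (qbinom[N,1]≡[N] (t + 1)) (cong [_] (+-comm t 1))))

  A≡V+B : A ≡ V + B
  A≡V+B = trans A≡A′ (trans A′≡V+B′ (cong (V +_) (sym B≡B′)))

  gain : ∀ s → 1 ≤ s → V * (A + C) < (V + s) * (A + s ⊓ C)
  gain s 1≤s rewrite A≡A′ | C≡C′ = gain′ t s 1≤t 1≤s m+m+t+2≤a

  bound : ∀ s → 13 * s ≤ q ^ (n ∸ (3 * k + 3 * t + 1)) → k ≤ 2 * t → t ≢ 2 →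
    (V + s) * (A + s ⊓ C) < X * D * E + D * D
  bound s small k≤2t t≢2 rewrite A≡A′ | C≡C′ | D≡D′ | E≡E′ | X≡u*[1+t] =
    bound′ t s (≤-trans small (^-monoʳ-≤ q n∸[3k+3t+1]≤1+a)) (k≤2t⇒m≤t k≤2t) t≢2

module IntegerForm where
  open import Data.Integer
  open import Data.Integer.Properties
  import Data.Nat as ℕ
  import Data.Nat.Properties as ℕ
  open import Relation.Binary.PropositionalEquality

  +a-+b≡+v : ∀ {a b v} → a ≡ v ℕ.+ b → + a - + b ≡ + v
  +a-+b≡+v {b = b} {v} refl =
    trans ([+m]-[+n]≡m⊖n (v ℕ.+ b) b) (trans (⊖-≥ (ℕ.m≤n+m b v)) (cong +_ (ℕ.m+n∸n≡m v b)))

  [+a-+b++s]*[+a++x]≡+[[v+s]*[a+x]] : ∀ {a b v} s x → a ≡ v ℕ.+ b →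
    (+ a - + b + + s) * (+ a + + x) ≡ + ((v ℕ.+ s) ℕ.* (a ℕ.+ x))
  [+a-+b++s]*[+a++x]≡+[[v+s]*[a+x]] {a} {b} {v} s x a≡v+b = begin
      (+ a - + b + + s) * (+ a + + x)
    ≡⟨ cong₂ _*_ (cong (_+ + s) (+a-+b≡+v {a} {b} {v} a≡v+b)) (sym (pos-+ a x)) ⟩
      (+ v + + s) * + (a ℕ.+ x)
    ≡⟨ cong (_* + (a ℕ.+ x)) (sym (pos-+ v s)) ⟩
      + (v ℕ.+ s) * + (a ℕ.+ x)
    ≡⟨ sym (pos-* (v ℕ.+ s) (a ℕ.+ x)) ⟩
      + ((v ℕ.+ s) ℕ.* (a ℕ.+ x))
    ∎
    where open ≡-Reasoning

  gain-ℤ : ∀ {a b c} v s → a ≡ v ℕ.+ b →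
    v ℕ.* (a ℕ.+ c) ℕ.< (v ℕ.+ s) ℕ.* (a ℕ.+ s ℕ.⊓ c) →
    (+ a - + b + + s) * (+ a + + (s ℕ.⊓ c)) > (+ a - + b) * (+ a + + c)
  gain-ℤ {a} {b} {c} v s a≡v+b gain = begin-strict
      (+ a - + b) * (+ a + + c)
    ≡⟨ cong₂ _*_ (+a-+b≡+v {a} {b} {v} a≡v+b) (sym (pos-+ a c)) ⟩
      + v * + (a ℕ.+ c)
    ≡⟨ sym (pos-* v (a ℕ.+ c)) ⟩
      + (v ℕ.* (a ℕ.+ c))
    <⟨ +<+ gain ⟩
      + ((v ℕ.+ s) ℕ.* (a ℕ.+ s ℕ.⊓ c))
    ≡⟨ sym ([+a-+b++s]*[+a++x]≡+[[v+s]*[a+x]] {a} {b} {v} s (s ℕ.⊓ c) a≡v+b) ⟩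
      (+ a - + b + + s) * (+ a + + (s ℕ.⊓ c))
    ∎
    where open ≤-Reasoning

  bound-ℤ : ∀ {a b c x d e} v s → a ≡ v ℕ.+ b →
    (v ℕ.+ s) ℕ.* (a ℕ.+ s ℕ.⊓ c) ℕ.< x ℕ.* d ℕ.* e ℕ.+ d ℕ.* d →
    (+ a - + b + + s) * (+ a + + (s ℕ.⊓ c)) < + x * + d * + e + + d * + d
  bound-ℤ {a} {b} {c} {x} {d} {e} v s a≡v+b bound = begin-strict
      (+ a - + b + + s) * (+ a + + (s ℕ.⊓ c))
    ≡⟨ [+a-+b++s]*[+a++x]≡+[[v+s]*[a+x]] {a} {b} {v} s (s ℕ.⊓ c) a≡v+b ⟩
      + ((v ℕ.+ s) ℕ.* (a ℕ.+ s ℕ.⊓ c))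
    <⟨ +<+ bound ⟩
      + (x ℕ.* d ℕ.* e ℕ.+ d ℕ.* d)
    ≡⟨ pos-+ (x ℕ.* d ℕ.* e) (d ℕ.* d) ⟩
      + (x ℕ.* d ℕ.* e) + + (d ℕ.* d)
    ≡⟨ cong₂ _+_ (trans (pos-* (x ℕ.* d) e) (cong (_* + e) (pos-* x d))) (pos-* d d) ⟩
      + x * + d * + e + + d * + d
    ∎
    where open ≤-Reasoning

module PrimePower where
  open import Data.Nat
  open import Data.Nat.Properties
  open import Data.Nat.Primality using (prime⇒nonTrivial)
  open import Data.Product using (_,_)
  open import Relation.Binary.PropositionalEquality using (refl)

  primePower⇒2≤ : ∀ {q} → IsPrimePower q → 2 ≤ q
  primePower⇒2≤ (p , suc e , p-prime , _ , refl) =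
    ≤-trans 2≤p (m≤m*n p (p ^ e) {{>-nonZero (m^n>0 p {{>-nonZero (≤-trans (s≤s z≤n) 2≤p)}} e)}})
    where
    2≤p : 2 ≤ p
    2≤p = nonTrivial⇒n>1 p {{prime⇒nonTrivial p-prime}}

open import Data.Nat using (ℕ; _^_; _∸_; _≤_; _⊓_)
open import Data.Integer using (ℤ; +_; _+_; _-_; _*_; _<_; _>_)
open import Data.Product using (_×_; _,_)
open import Relation.Binary.PropositionalEquality using (_≢_)
open IntegerForm
open PrimePower

lemma2p8 : (q n k t s : ℕ) → IsPrimePower q → 1 ≤ n → 1 ≤ k → 1 ≤ t → 1 ≤ s →
    t Data.Nat.+ 2 ≤ k →
    3 Data.Nat.* k Data.Nat.+ 3 Data.Nat.* t Data.Nat.+ 1 ≤ n →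
    13 Data.Nat.* s ≤ q ^ (n ∸ (3 Data.Nat.* k Data.Nat.+ 3 Data.Nat.* t Data.Nat.+ 1)) →
    let A : ℤ
        A = + gauss q (n ∸ t) (k ∸ t)
        B : ℤ
        B = + (q ^ ((k ∸ t) Data.Nat.* (k Data.Nat.+ 1 ∸ t)) Data.Nat.* gauss q (n ∸ k ∸ 1) (k ∸ t))
        C : ℕ
        C = q ^ (k ∸ t Data.Nat.+ 1) Data.Nat.* gauss q t 1
        g₁ : ℤ
        g₁ = (A - B + + s) * (A + + (s ⊓ C))
        D : ℤ
        D = + gauss q (n ∸ t ∸ 1) (k ∸ t ∸ 1)
        g₂ : ℤ
        g₂ = + (q ^ (k ∸ t) Data.Nat.* gauss q (t Data.Nat.+ 1) 1) * D * + gauss q (n ∸ t ∸ 1) (k ∸ t) + D * D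
    in (g₁ > (A - B) * (A + + C))
       × (k ≤ 2 Data.Nat.* t → t ≢ 2 → g₁ < g₂)
lemma2p8 q n k t s q-pp _ _ 1≤t 1≤s t+2≤k n-large small =
  gain-ℤ V s A≡V+B (gain s 1≤s) ,
  λ k≤2t t≢2 → bound-ℤ {x = X} {d = D} {e = E} V s A≡V+B (bound s small k≤2t t≢2)
  where open Reindexing (primePower⇒2≤ q-pp) 1≤t t+2≤k n-large
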